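{- Let $k\ge 2$ be an integer. The smallest $k$-admissible number is $2^{\binom{k}{2}+\nu_2(k)}$.
   Context: An integer $n>k$ is called $k$-admissible if $\binom{n}{k}$ is divisible by $2^{\binom{k}{2}}$. $\nu_2(x)$ denotes the 2-adic valuation of a positive integer $x$. -}

module Defs where

open import Data.Nat using (ℕ; zero; suc; _+_; _^_; _<_; _≤_)
open import Data.Nat.DivMod using (_/_; _%_)
open import Data.Nat.Divisibility using (_∣_)
open import Data.Nat.Combinatorics using (_C_)
open import Data.Product using (_×_)

-- Computed by repeated halving; the fuel argument (initialised to x) bounds
-- the number of halvings, which is always enough since ν₂ x ≤ x.
ν₂-go : ℕ → ℕ → ℕ
ν₂-go zero    x = zero
ν₂-go (suc f) zero = zero
ν₂-go (suc f) (suc x) with (suc x) % 2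
... | zero = suc (ν₂-go f (suc x / 2))
... | suc _ = zero

ν₂ : ℕ → ℕ
ν₂ x = ν₂-go x x

Admissible : ℕ → ℕ → Set
Admissible k n = (k < n) × (2 ^ (k C 2) ∣ n C k)

module Submission where

-- ν₂ (n C k) is the number of carries when k and n − k are added in base 2
-- (Kummer).  Below position ν₂ k the digits of k vanish, so no carry occurs
-- there, and no carry can reach past the leading digit of n; hence
-- 2 ^ (ν₂ (n C k) + ν₂ k) ≤ n, and an admissible n, having
-- ν₂ (n C k) ≥ k C 2, is at least N = 2 ^ (k C 2 + ν₂ k).  Conversely
-- k · (N C k) = N · ((N − 1) C (k − 1)) gives ν₂ (N C k) ≥ ν₂ N − ν₂ k = k C 2,
-- and N > k since k < 2 ^ (k C 2) for k ≥ 3.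

open import Defs
open import Data.Nat using (ℕ; _+_; _^_; _≤_)
open import Data.Nat.Combinatorics using (_C_)
open import Data.Product using (_×_)
open import Data.Nat
open import Data.Nat.Properties
open import Data.Nat.DivMod using (_%_; _/_; m*n%n≡0; [m+kn]%n≡m%n; m*n/n≡m; m*[n/m]≡n)
open import Data.Nat.Divisibility using (_∣_; divides)
open import Data.Nat.Combinatorics
  using (nCk≡n!/k![n-k]!; k![n∸k]!∣n!; nC1≡n; nCk+nC[k+1]≡[n+1]C[k+1])
open import Data.Nat.Tactic.RingSolver using (solve-∀)
open import Data.Product using (∃-syntax; ∃₂; _,_; proj₁; proj₂)
open import Function using (_∘_)
open import Relation.Nullary using (contradiction; yes; no)
open import Relation.Binary.PropositionalEquality
  using (_≡_; _≢_; refl; sym; trans; cong; cong₂; subst; module ≡-Reasoning)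

halve : ∀ m → ∃₂ λ r h → r ≤ 1 × m ≡ r + (h + h)
halve zero = 0 , 0 , z≤n , refl
halve (suc m) with halve m
... | 0 , h , _ , refl = 1 , h , ≤-refl , refl
... | 1 , h , _ , refl = 0 , suc h , z≤n , cong suc (sym (+-suc h h))
... | 2+ _ , _ , s≤s () , _

h+h≤1+n⇒h≤n : ∀ {h n} → h + h ≤ suc n → h ≤ n
h+h≤1+n⇒h≤n {zero} _ = z≤n
h+h≤1+n⇒h≤n {suc h} le = ≤-trans (m≤n+m (suc h) h) (s≤s⁻¹ le)

h+h≡h*2 : ∀ h → h + h ≡ h * 2
h+h≡h*2 h = trans (cong (h +_) (sym (+-identityʳ h))) (*-comm 2 h)

[h+h]%2≡0 : ∀ h → (h + h) % 2 ≡ 0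
[h+h]%2≡0 h = subst (λ m → m % 2 ≡ 0) (sym (h+h≡h*2 h)) (m*n%n≡0 h 2)

[1+h+h]%2≡1 : ∀ h → suc (h + h) % 2 ≡ 1
[1+h+h]%2≡1 h = subst (λ m → suc m % 2 ≡ 1) (sym (h+h≡h*2 h)) ([m+kn]%n≡m%n 1 h 2)

1+s+s≢q+q : ∀ s q → suc (s + s) ≢ q + q
1+s+s≢q+q s q eq = 1+n≢0 (trans (sym ([1+h+h]%2≡1 s)) (trans (cong (_% 2) eq) ([h+h]%2≡0 q)))

ν₂-go-even : ∀ f h → ν₂-go (suc f) (suc h + suc h) ≡ suc (ν₂-go f (suc h))
ν₂-go-even f h = trans (unfold _ ([h+h]%2≡0 (suc h)))
  (cong (suc ∘ ν₂-go f) (subst (λ m → m / 2 ≡ suc h) (sym (h+h≡h*2 (suc h))) (m*n/n≡m (suc h) 2)))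
  where
  unfold : ∀ x → suc x % 2 ≡ 0 → ν₂-go (suc f) (suc x) ≡ suc (ν₂-go f (suc x / 2))
  unfold x eq rewrite eq = refl

ν₂-go-odd : ∀ f h → ν₂-go (suc f) (suc (h + h)) ≡ 0
ν₂-go-odd f h = unfold ([1+h+h]%2≡1 h)
  where
  unfold : suc (h + h) % 2 ≡ 1 → ν₂-go (suc f) (suc (h + h)) ≡ 0
  unfold eq rewrite eq = refl

2^v*o+2^v*o≡2^[1+v]*o : ∀ v o → 2 ^ v * o + 2 ^ v * o ≡ 2 ^ suc v * o
2^v*o+2^v*o≡2^[1+v]*o v o = double (2 ^ v) o
  where
  double : ∀ p o → p * o + p * o ≡ 2 * p * o
  double = solve-∀

ν₂-go-decomposition : ∀ f m → 0 < m → m ≤ f → ∃[ t ] m ≡ 2 ^ ν₂-go f m * suc (t + t)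
ν₂-go-decomposition zero (suc _) _ ()
ν₂-go-decomposition (suc f) m 0<m m≤f with halve m
... | 1 , h , _ , refl rewrite ν₂-go-odd f h = h , sym (*-identityˡ _)
... | 2+ _ , _ , s≤s () , _
... | 0 , suc h , _ , refl rewrite ν₂-go-even f h
  with ν₂-go-decomposition f (suc h) (s≤s z≤n) (h+h≤1+n⇒h≤n m≤f)
...   | t , eq = t , trans (cong₂ _+_ eq eq) (2^v*o+2^v*o≡2^[1+v]*o (ν₂-go f (suc h)) (suc (t + t)))

ν₂-decomposition : ∀ m → 0 < m → ∃[ t ] m ≡ 2 ^ ν₂ m * suc (t + t)
ν₂-decomposition m 0<m = ν₂-go-decomposition m m 0<m ≤-refl

2^*odd-injective : ∀ v w {s t} → 2 ^ v * suc (s + s) ≡ 2 ^ w * suc (t + t) → v ≡ w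
2^*odd-injective zero zero eq = refl
2^*odd-injective zero (suc w) {s} {t} eq = contradiction
  (trans (sym (*-identityˡ _)) (trans eq (sym (2^v*o+2^v*o≡2^[1+v]*o w (suc (t + t))))))
  (1+s+s≢q+q s (2 ^ w * suc (t + t)))
2^*odd-injective (suc v) zero {s} {t} eq = contradiction
  (trans (sym (*-identityˡ _)) (trans (sym eq) (sym (2^v*o+2^v*o≡2^[1+v]*o v (suc (s + s))))))
  (1+s+s≢q+q t (2 ^ v * suc (s + s)))
2^*odd-injective (suc v) (suc w) {s} {t} eq = cong suc (2^*odd-injective v w {s} {t}
  (*-cancelˡ-≡ _ _ 2 (trans (sym (*-assoc 2 (2 ^ v) _)) (trans eq (*-assoc 2 (2 ^ w) _)))))

ν₂-unique : ∀ {m} v t → m ≡ 2 ^ v * suc (t + t) → ν₂ m ≡ v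
ν₂-unique {m} v t eq with ν₂-decomposition m (subst (0 <_) (sym eq) (*-mono-≤ (m^n>0 2 v) (s≤s z≤n)))
... | s , eq′ = 2^*odd-injective (ν₂ m) v {s} {t} (trans (sym eq′) eq)

ν₂[2^v]≡v : ∀ v → ν₂ (2 ^ v) ≡ v
ν₂[2^v]≡v v = ν₂-unique v 0 (sym (*-identityʳ (2 ^ v)))

ν₂[1+h+h]≡0 : ∀ h → ν₂ (suc (h + h)) ≡ 0
ν₂[1+h+h]≡0 h = ν₂-unique 0 h (sym (*-identityˡ _))

ν₂[m*n]≡ν₂[m]+ν₂[n] : ∀ {m n} → 0 < m → 0 < n → ν₂ (m * n) ≡ ν₂ m + ν₂ n
ν₂[m*n]≡ν₂[m]+ν₂[n] {m} {n} 0<m 0<n with ν₂-decomposition m 0<m | ν₂-decomposition n 0<n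
... | s , eqm | t , eqn = ν₂-unique (ν₂ m + ν₂ n) (s + t + (s * t + s * t)) (begin
  m * n                                              ≡⟨ cong₂ _*_ eqm eqn ⟩
  2 ^ ν₂ m * suc (s + s) * (2 ^ ν₂ n * suc (t + t))   ≡⟨ regroup (2 ^ ν₂ m) (2 ^ ν₂ n) s t ⟩
  2 ^ ν₂ m * 2 ^ ν₂ n * suc (s + t + (s * t + s * t) + (s + t + (s * t + s * t)))
    ≡⟨ cong (_* _) (^-distribˡ-+-* 2 (ν₂ m) (ν₂ n)) ⟨
  2 ^ (ν₂ m + ν₂ n) * _                                ∎)
  where
  open ≡-Reasoning
  regroup : ∀ p q s t → p * suc (s + s) * (q * suc (t + t))
                        ≡ p * q * suc (s + t + (s * t + s * t) + (s + t + (s * t + s * t)))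
  regroup = solve-∀

2^∣⇒≤ν₂ : ∀ {p m} → 0 < m → 2 ^ p ∣ m → p ≤ ν₂ m
2^∣⇒≤ν₂ {p} {m} 0<m (divides q eq) = subst (p ≤_) (sym ν₂m) (m≤n+m p (ν₂ q))
  where
  0<q : 0 < q
  0<q = n≢0⇒n>0 λ { refl → <⇒≢ 0<m (sym eq) }
  ν₂m : ν₂ m ≡ ν₂ q + p
  ν₂m = trans (cong ν₂ eq) (trans (ν₂[m*n]≡ν₂[m]+ν₂[n] 0<q (m^n>0 2 p)) (cong (ν₂ q +_) (ν₂[2^v]≡v p)))

≤ν₂⇒2^∣ : ∀ {p m} → 0 < m → p ≤ ν₂ m → 2 ^ p ∣ m
≤ν₂⇒2^∣ {p} {m} 0<m p≤ν₂m with ν₂-decomposition m 0<m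
... | t , eq = divides (2 ^ (ν₂ m ∸ p) * suc (t + t)) (begin
  m                                        ≡⟨ eq ⟩
  2 ^ ν₂ m * suc (t + t)                   ≡⟨ cong (λ e → 2 ^ e * suc (t + t)) (m+[n∸m]≡n p≤ν₂m) ⟨
  2 ^ (p + (ν₂ m ∸ p)) * suc (t + t)       ≡⟨ cong (_* suc (t + t)) (^-distribˡ-+-* 2 p (ν₂ m ∸ p)) ⟩
  2 ^ p * 2 ^ (ν₂ m ∸ p) * suc (t + t)     ≡⟨ regroup (2 ^ p) (2 ^ (ν₂ m ∸ p)) (suc (t + t)) ⟩
  2 ^ (ν₂ m ∸ p) * suc (t + t) * 2 ^ p     ∎)
  where
  open ≡-Reasoning
  regroup : ∀ a b c → a * b * c ≡ b * c * a
  regroup = solve-∀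

ν₂[h+h]≡1+ν₂[h] : ∀ {h} → 0 < h → ν₂ (h + h) ≡ suc (ν₂ h)
ν₂[h+h]≡1+ν₂[h] {h} 0<h with ν₂-decomposition h 0<h
... | t , eq = ν₂-unique (suc (ν₂ h)) t (trans (cong₂ _+_ eq eq) (2^v*o+2^v*o≡2^[1+v]*o (ν₂ h) (suc (t + t))))

ν₂-!-suc : ∀ n → ν₂ (suc n !) ≡ ν₂ (suc n) + ν₂ (n !)
ν₂-!-suc n = ν₂[m*n]≡ν₂[m]+ν₂[n] (s≤s z≤n) (1≤n! n)

ν₂[[1+h+h]!]≡ν₂[[h+h]!] : ∀ h → ν₂ (suc (h + h) !) ≡ ν₂ ((h + h) !)
ν₂[[1+h+h]!]≡ν₂[[h+h]!] h = trans (ν₂-!-suc (h + h)) (cong (_+ ν₂ ((h + h) !)) (ν₂[1+h+h]≡0 h))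

ν₂[[h+h]!]≡h+ν₂[h!] : ∀ h → ν₂ ((h + h) !) ≡ h + ν₂ (h !)
ν₂[[h+h]!]≡h+ν₂[h!] zero = refl
ν₂[[h+h]!]≡h+ν₂[h!] (suc h) = begin
  ν₂ (suc (h + suc h) !)
    ≡⟨ ν₂-!-suc (h + suc h) ⟩
  ν₂ (suc h + suc h) + ν₂ ((h + suc h) !)
    ≡⟨ cong₂ _+_ (ν₂[h+h]≡1+ν₂[h] (s≤s z≤n)) (cong (ν₂ ∘ _!) (+-suc h h)) ⟩
  suc (ν₂ (suc h)) + ν₂ (suc (h + h) !)
    ≡⟨ cong (suc (ν₂ (suc h)) +_) (trans (ν₂[[1+h+h]!]≡ν₂[[h+h]!] h) (ν₂[[h+h]!]≡h+ν₂[h!] h)) ⟩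
  suc (ν₂ (suc h)) + (h + ν₂ (h !))
    ≡⟨ cong suc (x+[y+z]≡y+[x+z] (ν₂ (suc h)) h (ν₂ (h !))) ⟩
  suc h + (ν₂ (suc h) + ν₂ (h !))
    ≡⟨ cong (suc h +_) (ν₂-!-suc h) ⟨
  suc h + ν₂ (suc h !)
    ∎
  where
  open ≡-Reasoning
  x+[y+z]≡y+[x+z] : ∀ x y z → x + (y + z) ≡ y + (x + z)
  x+[y+z]≡y+[x+z] = solve-∀

ν₂[[r+h+h]!]≡h+ν₂[h!] : ∀ {r} → r ≤ 1 → ∀ h → ν₂ ((r + (h + h)) !) ≡ h + ν₂ (h !)
ν₂[[r+h+h]!]≡h+ν₂[h!] {0} _ h = ν₂[[h+h]!]≡h+ν₂[h!] h
ν₂[[r+h+h]!]≡h+ν₂[h!] {1} _ h = trans (ν₂[[1+h+h]!]≡ν₂[[h+h]!] h) (ν₂[[h+h]!]≡h+ν₂[h!] h)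
ν₂[[r+h+h]!]≡h+ν₂[h!] {2+ _} (s≤s ()) _

x!*y!*[x+y]Cx≡[x+y]! : ∀ x y → x ! * y ! * ((x + y) C x) ≡ (x + y) !
x!*y!*[x+y]Cx≡[x+y]! x y = subst (λ z → x ! * z ! * ((x + y) C x) ≡ (x + y) !) (m+n∸m≡n x y) (begin
  x ! * (x + y ∸ x) ! * ((x + y) C x)               ≡⟨ cong (x ! * (x + y ∸ x) ! *_) (nCk≡n!/k![n-k]! x≤x+y) ⟩
  x ! * (x + y ∸ x) ! * ((x + y) ! / (x ! * (x + y ∸ x) !))
                                                    ≡⟨ m*[n/m]≡n (k![n∸k]!∣n! x≤x+y) ⟩
  (x + y) !                                         ∎)
  where
  open ≡-Reasoning
  x≤x+y : x ≤ x + y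
  x≤x+y = m≤m+n x y
  instance
    x!*[x+y∸x]!≢0 : NonZero (x ! * (x + y ∸ x) !)
    x!*[x+y∸x]!≢0 = x !* (x + y ∸ x) !≢0

0<[x+y]Cx : ∀ x y → 0 < (x + y) C x
0<[x+y]Cx x y = n≢0⇒n>0 λ C≡0 → <⇒≢ (1≤n! (x + y)) (sym (begin
  (x + y) !                       ≡⟨ x!*y!*[x+y]Cx≡[x+y]! x y ⟨
  x ! * y ! * ((x + y) C x)       ≡⟨ cong (x ! * y ! *_) C≡0 ⟩
  x ! * y ! * 0                   ≡⟨ *-zeroʳ (x ! * y !) ⟩
  0                               ∎))
  where open ≡-Reasoning

ν₂-!-binomial : ∀ x y → ν₂ ((x + y) !) ≡ ν₂ (x !) + ν₂ (y !) + ν₂ ((x + y) C x)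
ν₂-!-binomial x y = begin
  ν₂ ((x + y) !)
    ≡⟨ cong ν₂ (x!*y!*[x+y]Cx≡[x+y]! x y) ⟨
  ν₂ (x ! * y ! * ((x + y) C x))
    ≡⟨ ν₂[m*n]≡ν₂[m]+ν₂[n] (*-mono-≤ (1≤n! x) (1≤n! y)) (0<[x+y]Cx x y) ⟩
  ν₂ (x ! * y !) + ν₂ ((x + y) C x)
    ≡⟨ cong (_+ ν₂ ((x + y) C x)) (ν₂[m*n]≡ν₂[m]+ν₂[n] (1≤n! x) (1≤n! y)) ⟩
  ν₂ (x !) + ν₂ (y !) + ν₂ ((x + y) C x)
    ∎
  where open ≡-Reasoning

h+h≤3⇒h≤1 : ∀ {h} → h + h ≤ 3 → h ≤ 1
h+h≤3⇒h≤1 {h} le with h ≤? 1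
... | yes h≤1 = h≤1
... | no h≰1 = contradiction (≤-trans (+-mono-≤ (≰⇒> h≰1) (≰⇒> h≰1)) le) λ { (s≤s (s≤s (s≤s ()))) }

2^[c+w]≤[u+A+A]⊔1 : ∀ {c w A} u → c ≤ 1 → c ≤ A → 2 ^ w ≤ A ⊔ 1 → 2 ^ (c + w) ≤ (u + (A + A)) ⊔ 1
2^[c+w]≤[u+A+A]⊔1 {0} {w} {A} u _ _ 2^w≤A⊔1 =
  ≤-trans 2^w≤A⊔1 (⊔-monoˡ-≤ 1 (≤-trans (m≤m+n A A) (m≤n+m (A + A) u)))
2^[c+w]≤[u+A+A]⊔1 {1} {w} {A} u _ 1≤A 2^w≤A⊔1 = begin
  2 * 2 ^ w          ≤⟨ *-monoʳ-≤ 2 (≤-trans 2^w≤A⊔1 (≤-reflexive (m≥n⇒m⊔n≡m 1≤A))) ⟩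
  2 * A              ≡⟨ cong (A +_) (+-identityʳ A) ⟩
  A + A              ≤⟨ m≤n+m (A + A) u ⟩
  u + (A + A)        ≤⟨ m≤m⊔n (u + (A + A)) 1 ⟩
  (u + (A + A)) ⊔ 1  ∎
  where open ≤-Reasoning
2^[c+w]≤[u+A+A]⊔1 {2+ _} _ (s≤s ()) _ _

carry-split : ∀ c r s u c′ a b → c + (r + s) ≡ u + (c′ + c′) →
  c + (r + (a + a) + (s + (b + b))) ≡ u + ((c′ + (a + b)) + (c′ + (a + b)))
carry-split c r s u c′ a b c+r+s≡u+2c′ = begin
  c + (r + (a + a) + (s + (b + b)))    ≡⟨ split c r s a b ⟩
  c + (r + s) + ((a + b) + (a + b))    ≡⟨ cong (_+ ((a + b) + (a + b))) c+r+s≡u+2c′ ⟩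
  u + (c′ + c′) + ((a + b) + (a + b))  ≡⟨ merge u c′ (a + b) ⟩
  u + ((c′ + (a + b)) + (c′ + (a + b))) ∎
  where
  open ≡-Reasoning
  split : ∀ c r s a b → c + (r + (a + a) + (s + (b + b))) ≡ c + (r + s) + ((a + b) + (a + b))
  split = solve-∀
  merge : ∀ u c′ d → u + (c′ + c′) + (d + d) ≡ u + ((c′ + d) + (c′ + d))
  merge = solve-∀

-- w is the number of carries in the binary addition of x, y and the carry-in c:
-- one halving step produces the carry c′ out of the lowest digit.
ν₂-!-carries : ∀ n x y {c} → x + y ≤ n → c ≤ 1 →
  ∃[ w ] ν₂ ((c + (x + y)) !) ≡ ν₂ (x !) + ν₂ (y !) + w × 2 ^ w ≤ (c + (x + y)) ⊔ 1
ν₂-!-carries zero zero zero {0} _ _ = 0 , refl , ≤-refl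
ν₂-!-carries zero zero zero {1} _ _ = 0 , refl , ≤-refl
ν₂-!-carries zero zero zero {2+ _} _ (s≤s ())
ν₂-!-carries (suc n) x y {c} x+y≤1+n c≤1 with halve x | halve y
... | r , a , r≤1 , refl | s , b , s≤1 , refl with halve (c + (r + s))
... | u , c′ , u≤1 , c+r+s≡u+2c′ =
  c′ + w′ , ν₂-eq , subst (λ z → 2 ^ (c′ + w′) ≤ z ⊔ 1) (sym total)
    (2^[c+w]≤[u+A+A]⊔1 u c′≤1 (m≤m+n c′ (a + b)) 2^w′≤A⊔1)
  where
  open ≡-Reasoning
  A : ℕ
  A = c′ + (a + b)
  total : c + (r + (a + a) + (s + (b + b))) ≡ u + (A + A)
  total = carry-split c r s u c′ a b c+r+s≡u+2c′
  a+b≤n : a + b ≤ n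
  a+b≤n = h+h≤1+n⇒h≤n (≤-trans (≤-reflexive (regroup a b))
            (≤-trans (+-mono-≤ (m≤n+m (a + a) r) (m≤n+m (b + b) s)) x+y≤1+n))
    where
    regroup : ∀ a b → (a + b) + (a + b) ≡ (a + a) + (b + b)
    regroup = solve-∀
  c′≤1 : c′ ≤ 1
  c′≤1 = h+h≤3⇒h≤1 (≤-trans (m≤n+m (c′ + c′) u) (≤-trans (≤-reflexive (sym c+r+s≡u+2c′))
           (+-mono-≤ c≤1 (+-mono-≤ r≤1 s≤1))))
  ih : ∃[ w ] ν₂ (A !) ≡ ν₂ (a !) + ν₂ (b !) + w × 2 ^ w ≤ A ⊔ 1
  ih = ν₂-!-carries n a b a+b≤n c′≤1
  w′ : ℕ
  w′ = proj₁ ih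
  ν₂[A!] : ν₂ (A !) ≡ ν₂ (a !) + ν₂ (b !) + w′
  ν₂[A!] = proj₁ (proj₂ ih)
  2^w′≤A⊔1 : 2 ^ w′ ≤ A ⊔ 1
  2^w′≤A⊔1 = proj₂ (proj₂ ih)
  ν₂-eq : ν₂ ((c + (r + (a + a) + (s + (b + b)))) !)
          ≡ ν₂ ((r + (a + a)) !) + ν₂ ((s + (b + b)) !) + (c′ + w′)
  ν₂-eq = begin
    ν₂ ((c + (r + (a + a) + (s + (b + b)))) !)
      ≡⟨ cong (ν₂ ∘ _!) total ⟩
    ν₂ ((u + (A + A)) !)
      ≡⟨ ν₂[[r+h+h]!]≡h+ν₂[h!] u≤1 A ⟩
    A + ν₂ (A !)
      ≡⟨ cong (A +_) ν₂[A!] ⟩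
    c′ + (a + b) + (ν₂ (a !) + ν₂ (b !) + w′)
      ≡⟨ regroup c′ a b (ν₂ (a !)) (ν₂ (b !)) w′ ⟩
    (a + ν₂ (a !)) + (b + ν₂ (b !)) + (c′ + w′)
      ≡⟨ cong₂ (λ p q → p + q + (c′ + w′)) (ν₂[[r+h+h]!]≡h+ν₂[h!] r≤1 a) (ν₂[[r+h+h]!]≡h+ν₂[h!] s≤1 b) ⟨
    ν₂ ((r + (a + a)) !) + ν₂ ((s + (b + b)) !) + (c′ + w′)
      ∎
    where
    regroup : ∀ c′ a b p q w′ → c′ + (a + b) + (p + q + w′) ≡ (a + p) + (b + q) + (c′ + w′)
    regroup = solve-∀

2^ν₂[[x+y]Cx]≤[x+y]⊔1 : ∀ x y → 2 ^ ν₂ ((x + y) C x) ≤ (x + y) ⊔ 1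
2^ν₂[[x+y]Cx]≤[x+y]⊔1 x y with ν₂-!-carries (x + y) x y {0} ≤-refl z≤n
... | w , ν₂[[x+y]!]≡…+w , 2^w≤ = subst (λ e → 2 ^ e ≤ (x + y) ⊔ 1) (sym ν₂C≡w) 2^w≤
  where
  ν₂C≡w : ν₂ ((x + y) C x) ≡ w
  ν₂C≡w = +-cancelˡ-≡ (ν₂ (x !) + ν₂ (y !)) _ _ (trans (sym (ν₂-!-binomial x y)) ν₂[[x+y]!]≡…+w)

ν₂[[2h+r+2m]C2h]≡ν₂[[h+m]Ch] : ∀ {r} → r ≤ 1 → ∀ h m →
  ν₂ ((h + h + (r + (m + m))) C (h + h)) ≡ ν₂ ((h + m) C h)
ν₂[[2h+r+2m]C2h]≡ν₂[[h+m]Ch] {r} r≤1 h m = sym (+-cancelˡ-≡ K _ _ (begin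
  K + ν₂ ((h + m) C h)
    ≡⟨ regroup h m (ν₂ (h !)) (ν₂ (m !)) _ ⟩
  (h + m) + (ν₂ (h !) + ν₂ (m !) + ν₂ ((h + m) C h))
    ≡⟨ cong ((h + m) +_) (ν₂-!-binomial h m) ⟨
  (h + m) + ν₂ ((h + m) !)
    ≡⟨ ν₂[[r+h+h]!]≡h+ν₂[h!] r≤1 (h + m) ⟨
  ν₂ ((r + ((h + m) + (h + m))) !)
    ≡⟨ cong (ν₂ ∘ _!) (shuffle r h m) ⟩
  ν₂ ((h + h + (r + (m + m))) !)
    ≡⟨ ν₂-!-binomial (h + h) (r + (m + m)) ⟩
  ν₂ ((h + h) !) + ν₂ ((r + (m + m)) !) + L
    ≡⟨ cong₂ (λ p q → p + q + L) (ν₂[[h+h]!]≡h+ν₂[h!] h) (ν₂[[r+h+h]!]≡h+ν₂[h!] r≤1 m) ⟩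
  K + L
    ∎))
  where
  open ≡-Reasoning
  K : ℕ
  K = (h + ν₂ (h !)) + (m + ν₂ (m !))
  L : ℕ
  L = ν₂ ((h + h + (r + (m + m))) C (h + h))
  regroup : ∀ h m p q e → (h + p) + (m + q) + e ≡ (h + m) + (p + q + e)
  regroup = solve-∀
  shuffle : ∀ r h m → r + ((h + m) + (h + m)) ≡ h + h + (r + (m + m))
  shuffle = solve-∀

2^[ν₂[[x+y]Cx]+t]≤x+y : ∀ t {x} y → 0 < x → ν₂ x ≡ t → 2 ^ (ν₂ ((x + y) C x) + t) ≤ x + y
2^[ν₂[[x+y]Cx]+t]≤x+y zero {x} y 0<x _ = begin
  2 ^ (ν₂ ((x + y) C x) + 0)   ≡⟨ cong (2 ^_) (+-identityʳ (ν₂ ((x + y) C x))) ⟩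
  2 ^ ν₂ ((x + y) C x)         ≤⟨ 2^ν₂[[x+y]Cx]≤[x+y]⊔1 x y ⟩
  (x + y) ⊔ 1                  ≡⟨ m≥n⇒m⊔n≡m (≤-trans 0<x (m≤m+n x y)) ⟩
  x + y                        ∎
  where open ≤-Reasoning
2^[ν₂[[x+y]Cx]+t]≤x+y (suc t) {x} y 0<x ν₂x≡1+t with halve x
... | 1 , h , _ , refl = contradiction (trans (sym (ν₂[1+h+h]≡0 h)) ν₂x≡1+t) λ ()
... | 2+ _ , _ , s≤s () , _
... | 0 , zero , _ , refl with () ← 0<x
... | 0 , h@(suc _) , _ , refl with halve y
...   | s , m , s≤1 , refl = begin
  2 ^ (ν₂ ((h + h + y′) C (h + h)) + suc t)
    ≡⟨ cong (2 ^_) (+-suc (ν₂ ((h + h + y′) C (h + h))) t) ⟩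
  2 * 2 ^ (ν₂ ((h + h + y′) C (h + h)) + t)
    ≡⟨ cong (λ e → 2 * 2 ^ (e + t)) (ν₂[[2h+r+2m]C2h]≡ν₂[[h+m]Ch] s≤1 h m) ⟩
  2 * 2 ^ (ν₂ ((h + m) C h) + t)
    ≤⟨ *-monoʳ-≤ 2 (2^[ν₂[[x+y]Cx]+t]≤x+y t m (s≤s z≤n) ν₂h≡t) ⟩
  2 * (h + m)
    ≡⟨ double h m ⟩
  h + h + (m + m)
    ≤⟨ +-monoʳ-≤ (h + h) (m≤n+m (m + m) s) ⟩
  h + h + y′
    ∎
  where
  open ≤-Reasoning
  y′ : ℕ
  y′ = s + (m + m)
  ν₂h≡t : ν₂ h ≡ t
  ν₂h≡t = suc-injective (trans (sym (ν₂[h+h]≡1+ν₂[h] (s≤s z≤n))) ν₂x≡1+t)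
  double : ∀ h m → 2 * (h + m) ≡ h + h + (m + m)
  double = solve-∀

[1+x]*[[1+x+y]C[1+x]]≡[1+x+y]*[[x+y]Cx] : ∀ x y →
  suc x * ((suc x + y) C suc x) ≡ suc (x + y) * ((x + y) C x)
[1+x]*[[1+x+y]C[1+x]]≡[1+x+y]*[[x+y]Cx] x y = *-cancelˡ-≡ _ _ (x ! * y !) {{x !* y !≢0}} (begin
  x ! * y ! * (suc x * ((suc x + y) C suc x))   ≡⟨ regroup (x !) (y !) (suc x) _ ⟩
  suc x ! * y ! * ((suc x + y) C suc x)         ≡⟨ x!*y!*[x+y]Cx≡[x+y]! (suc x) y ⟩
  suc (x + y) * (x + y) !                       ≡⟨ cong (suc (x + y) *_) (x!*y!*[x+y]Cx≡[x+y]! x y) ⟨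
  suc (x + y) * (x ! * y ! * ((x + y) C x))     ≡⟨ regroup′ (x !) (y !) (suc (x + y)) _ ⟩
  x ! * y ! * (suc (x + y) * ((x + y) C x))     ∎)
  where
  open ≡-Reasoning
  regroup : ∀ a b s c → a * b * (s * c) ≡ s * a * b * c
  regroup = solve-∀
  regroup′ : ∀ a b s c → s * (a * b * c) ≡ a * b * (s * c)
  regroup′ = solve-∀

ν₂[x+y]≤ν₂[x]+ν₂[[x+y]Cx] : ∀ {x} y → 0 < x → ν₂ (x + y) ≤ ν₂ x + ν₂ ((x + y) C x)
ν₂[x+y]≤ν₂[x]+ν₂[[x+y]Cx] {suc x} y _ = begin
  ν₂ (suc (x + y))
    ≤⟨ m≤m+n _ _ ⟩
  ν₂ (suc (x + y)) + ν₂ ((x + y) C x)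
    ≡⟨ ν₂[m*n]≡ν₂[m]+ν₂[n] (s≤s z≤n) (0<[x+y]Cx x y) ⟨
  ν₂ (suc (x + y) * ((x + y) C x))
    ≡⟨ cong ν₂ ([1+x]*[[1+x+y]C[1+x]]≡[1+x+y]*[[x+y]Cx] x y) ⟨
  ν₂ (suc x * ((suc x + y) C suc x))
    ≡⟨ ν₂[m*n]≡ν₂[m]+ν₂[n] (s≤s z≤n) (0<[x+y]Cx (suc x) y) ⟩
  ν₂ (suc x) + ν₂ ((suc x + y) C suc x)
    ∎
  where open ≤-Reasoning

0<nCk : ∀ {n k} → k ≤ n → 0 < n C k
0<nCk {n} {k} k≤n = subst (λ n → 0 < n C k) (m+[n∸m]≡n k≤n) (0<[x+y]Cx k (n ∸ k))

ν₂[n]≤ν₂[k]+ν₂[nCk] : ∀ {n k} → 0 < k → k ≤ n → ν₂ n ≤ ν₂ k + ν₂ (n C k)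
ν₂[n]≤ν₂[k]+ν₂[nCk] {n} {k} 0<k k≤n =
  subst (λ n → ν₂ n ≤ ν₂ k + ν₂ (n C k)) (m+[n∸m]≡n k≤n) (ν₂[x+y]≤ν₂[x]+ν₂[[x+y]Cx] (n ∸ k) 0<k)

2^[ν₂[nCk]+ν₂[k]]≤n : ∀ {n k} → 0 < k → k ≤ n → 2 ^ (ν₂ (n C k) + ν₂ k) ≤ n
2^[ν₂[nCk]+ν₂[k]]≤n {n} {k} 0<k k≤n =
  subst (λ n → 2 ^ (ν₂ (n C k) + ν₂ k) ≤ n) (m+[n∸m]≡n k≤n) (2^[ν₂[[x+y]Cx]+t]≤x+y (ν₂ k) (n ∸ k) 0<k refl)

3+j<2^[[3+j]C2] : ∀ j → 3 + j < 2 ^ ((3 + j) C 2)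
3+j<2^[[3+j]C2] zero = s≤s (s≤s (s≤s (s≤s z≤n)))
3+j<2^[[3+j]C2] (suc j) = begin
  5 + j                   ≤⟨ m≤m+n (5 + j) n ⟩
  5 + j + n               ≡⟨ double j ⟩
  2 * (4 + j)             ≤⟨ *-monoʳ-≤ 2 (3+j<2^[[3+j]C2] j) ⟩
  2 * 2 ^ (n C 2)         ≤⟨ *-monoˡ-≤ (2 ^ (n C 2)) (^-monoʳ-≤ 2 {1} {n} (s≤s z≤n)) ⟩
  2 ^ n * 2 ^ (n C 2)     ≡⟨ ^-distribˡ-+-* 2 n (n C 2) ⟨
  2 ^ (n + n C 2)         ≡⟨ cong (λ e → 2 ^ (e + n C 2)) (nC1≡n n) ⟨
  2 ^ (n C 1 + n C 2)     ≡⟨ cong (2 ^_) (nCk+nC[k+1]≡[n+1]C[k+1] n 1) ⟩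
  2 ^ (suc n C 2)         ∎
  where
  open ≤-Reasoning
  n : ℕ
  n = 3 + j
  double : ∀ j → 5 + j + (3 + j) ≡ 2 * (4 + j)
  double = solve-∀

k<2^[kC2+ν₂[k]] : ∀ {k} → 2 ≤ k → k < 2 ^ (k C 2 + ν₂ k)
k<2^[kC2+ν₂[k]] {2} _ = s≤s (s≤s (s≤s z≤n))
k<2^[kC2+ν₂[k]] {suc (suc (suc j))} _ =
  ≤-trans (3+j<2^[[3+j]C2] j) (^-monoʳ-≤ 2 (m≤m+n ((3 + j) C 2) (ν₂ (3 + j))))
k<2^[kC2+ν₂[k]] {1} (s≤s ())

mainTheorem2 : (k : ℕ) → 2 ≤ k →
    Admissible k (2 ^ (k C 2 + ν₂ k)) × ((n : ℕ) → Admissible k n → 2 ^ (k C 2 + ν₂ k) ≤ n)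
mainTheorem2 k 2≤k = (k<N , ≤ν₂⇒2^∣ (0<nCk k≤N) kC2≤ν₂[NCk]) , minimal
  where
  N : ℕ
  N = 2 ^ (k C 2 + ν₂ k)
  0<k : 0 < k
  0<k = ≤-trans (s≤s z≤n) 2≤k
  k<N : k < N
  k<N = k<2^[kC2+ν₂[k]] 2≤k
  k≤N : k ≤ N
  k≤N = <⇒≤ k<N
  kC2≤ν₂[NCk] : k C 2 ≤ ν₂ (N C k)
  kC2≤ν₂[NCk] = +-cancelˡ-≤ (ν₂ k) _ _ (begin
    ν₂ k + k C 2     ≡⟨ +-comm (ν₂ k) (k C 2) ⟩
    k C 2 + ν₂ k     ≡⟨ ν₂[2^v]≡v (k C 2 + ν₂ k) ⟨
    ν₂ N             ≤⟨ ν₂[n]≤ν₂[k]+ν₂[nCk] 0<k k≤N ⟩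
    ν₂ k + ν₂ (N C k) ∎)
    where open ≤-Reasoning
  minimal : (n : ℕ) → Admissible k n → N ≤ n
  minimal n (k<n , 2^kC2∣nCk) = ≤-trans
    (^-monoʳ-≤ 2 (+-monoˡ-≤ (ν₂ k) (2^∣⇒≤ν₂ {k C 2} (0<nCk (<⇒≤ k<n)) 2^kC2∣nCk)))
    (2^[ν₂[nCk]+ν₂[k]]≤n 0<k (<⇒≤ k<n))
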